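{- Let $G=(V,E)$ be a finite simple graph of order $n\geq 4$ with no isolated vertices, and let $\delta(G)$ denote its minimum degree. Then every subset of $V$ of cardinality $\lfloor n/2\rfloor$ is a fort of $G$ if and only if $\delta(G)\geq\lceil n/2\rceil+1$. Similarly, every subset of $V$ of cardinality $\lceil n/2\rceil$ is a fort of $G$ if and only if $\delta(G)\geq\lfloor n/2\rfloor+1$.
   Context: A fort of a finite simple graph $G=(V,E)$ is a non-empty subset $F\subseteq V$ such that no vertex $u\in V\setminus F$ has exactly one neighbor in $F$. -}

module Defs where

open import Data.Nat using (ℕ; zero; suc; _⊓_)
open import Data.Bool using (Bool; true; false; _∧_)
open import Data.Fin using (Fin)
open import Data.Fin.Subset using (Subset; _∈_; _∉_; Nonempty)
open import Data.Vec using (tabulate; countᵇ; foldr₁; lookup; allFin)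
open import Data.Product using (_×_)
open import Relation.Binary.PropositionalEquality using (_≡_)
open import Relation.Nullary using (¬_)

record Graph (n : ℕ) : Set where
  field
    adj   : Fin n → Fin n → Bool
    sym   : ∀ u v → adj u v ≡ adj v u
    irrefl : ∀ v → adj v v ≡ false
open Graph public

degree : ∀ {n} → Graph n → Fin n → ℕ
degree G u = countᵇ (adj G u) (allFin _)

neighboursIn : ∀ {n} → Graph n → Subset n → Fin n → ℕ
neighboursIn G F u = countᵇ (λ v → adj G u v ∧ lookup F v) (allFin _)

-- minimum degree δ(G) (convention δ = 0 for the empty graph; unused since n ≥ 4)
minDegree : ∀ {n} → Graph n → ℕ
minDegree {zero}  G = 0
minDegree {suc n} G = foldr₁ _⊓_ (tabulate (degree G))

NoIsolated : ∀ {n} → Graph n → Set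
NoIsolated G = ∀ v → ¬ (degree G v ≡ 0)

IsFort : ∀ {n} → Graph n → Subset n → Set
IsFort G F = Nonempty F × (∀ u → u ∉ F → ¬ (neighboursIn G F u ≡ 1))

{-# OPTIONS --safe #-}
-- Write n = k + j with k ≥ 1. If u ∉ F has exactly one neighbour in F, its other neighbours lie in
-- the complement of F, which also contains u itself, so deg u ≤ |V ∖ F| = j; hence δ > j makes every
-- k-set a fort. Conversely, a vertex u with deg u ≤ j has a neighbour w and at least k − 1 vertices
-- other than u outside its neighbourhood; w together with k − 1 of them is a k-set that is not a
-- fort, u having exactly one neighbour in it. Taking {k, j} = {⌊n/2⌋, ⌈n/2⌉} gives both statements.
module Submission where

open import Defs hiding (sym)
open import Data.Nat using (ℕ; zero; suc; _≤_; _<_; _+_; _∸_; _⊓_; ⌊_/2⌋; ⌈_/2⌉; z≤n; s≤s; s≤s⁻¹)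
open import Data.Nat.Properties
  using (+-suc; +-comm; +-monoʳ-≤; <⇒≢; <⇒≤; <⇒≱; n≢0⇒n>0; ≮⇒≥; _<?_; ⊓-glb; m≤n⊓o⇒m≤n; m≤n⊓o⇒m≤o;
         m+n≤o⇒m≤o∸n; module ≤-Reasoning; m+n∸m≡n; ⌊n/2⌋+⌈n/2⌉≡n; ⌊n/2⌋-mono; ⌈n/2⌉-mono)
open import Data.Bool using (Bool; true; false; _∧_)
open import Data.Fin using (Fin; zero; suc)
open import Data.Fin.Subset
open import Data.Fin.Subset.Properties
open import Data.Vec using (_∷_; []; here; there; lookup; tabulate; countᵇ; foldr₁)
open import Data.Vec.Properties using (lookup∘tabulate; []=⇒lookup)
open import Data.Product using (_×_; _,_; ∃-syntax; proj₁; proj₂)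
open import Data.Sum using (inj₁; inj₂)
open import Data.Empty using (⊥-elim)
open import Function using (_∘_; id)
open import Function.Bundles using (_⇔_; mk⇔; Equivalence)
open import Function.Construct.Composition using (_⇔-∘_)
open import Function.Construct.Symmetry using (⇔-sym)
open import Relation.Nullary using (¬_; yes; no; contradiction)
open import Relation.Binary.PropositionalEquality

private
  variable
    n : ℕ
    p : Subset n

Disjoint : Subset n → Subset n → Set
Disjoint p q = ∀ {x} → x ∈ p → x ∉ q

∣p∪q∣≡∣p∣+∣q∣ : ∀ (p q : Subset n) → Disjoint p q → ∣ p ∪ q ∣ ≡ ∣ p ∣ + ∣ q ∣
∣p∪q∣≡∣p∣+∣q∣ []          []          disjoint = refl
∣p∪q∣≡∣p∣+∣q∣ (true ∷ p)  (true ∷ q)  disjoint = ⊥-elim (disjoint here here)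
∣p∪q∣≡∣p∣+∣q∣ (true ∷ p)  (false ∷ q) disjoint =
  cong suc (∣p∪q∣≡∣p∣+∣q∣ p q λ x∈p x∈q → disjoint (there x∈p) (there x∈q))
∣p∪q∣≡∣p∣+∣q∣ (false ∷ p) (true ∷ q)  disjoint =
  trans (cong suc (∣p∪q∣≡∣p∣+∣q∣ p q λ x∈p x∈q → disjoint (there x∈p) (there x∈q))) (sym (+-suc _ _))
∣p∪q∣≡∣p∣+∣q∣ (false ∷ p) (false ∷ q) disjoint =
  ∣p∪q∣≡∣p∣+∣q∣ p q λ x∈p x∈q → disjoint (there x∈p) (there x∈q)

∣p∣≡∣p∩q∣+∣p∩∁q∣ : ∀ (p q : Subset n) → ∣ p ∣ ≡ ∣ p ∩ q ∣ + ∣ p ∩ ∁ q ∣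
∣p∣≡∣p∩q∣+∣p∩∁q∣ p q = begin
  ∣ p ∣                     ≡⟨ cong ∣_∣ (sym (∩-identityʳ p)) ⟩
  ∣ p ∩ ⊤ ∣                 ≡⟨ cong (λ r → ∣ p ∩ r ∣) (sym (p∪∁p≡⊤ q)) ⟩
  ∣ p ∩ (q ∪ ∁ q) ∣         ≡⟨ cong ∣_∣ (∩-distribˡ-∪ p q (∁ q)) ⟩
  ∣ p ∩ q ∪ p ∩ ∁ q ∣       ≡⟨ ∣p∪q∣≡∣p∣+∣q∣ (p ∩ q) (p ∩ ∁ q) disjoint ⟩
  ∣ p ∩ q ∣ + ∣ p ∩ ∁ q ∣   ∎
  where
  open ≡-Reasoning
  disjoint : Disjoint (p ∩ q) (p ∩ ∁ q)
  disjoint x∈p∩q x∈p∩∁q = x∈p⇒x∉∁p (proj₂ (x∈p∩q⁻ p q x∈p∩q)) (proj₂ (x∈p∩q⁻ p (∁ q) x∈p∩∁q))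

0<∣p∣⇒Nonempty : 0 < ∣ p ∣ → Nonempty p
0<∣p∣⇒Nonempty {n} {p} 0<∣p∣ with nonempty? p
... | yes p-nonempty = p-nonempty
... | no  p-empty = contradiction (trans (cong ∣_∣ (Empty-unique p-empty)) (∣⊥∣≡0 n)) (<⇒≢ 0<∣p∣ ∘ sym)

m≤∣p∣⇒∃q⊆p∣q∣≡m : ∀ (p : Subset n) {m} → m ≤ ∣ p ∣ → ∃[ q ] q ⊆ p × ∣ q ∣ ≡ m
m≤∣p∣⇒∃q⊆p∣q∣≡m []          z≤n = [] , id , refl
m≤∣p∣⇒∃q⊆p∣q∣≡m (false ∷ p) m≤∣p∣ with m≤∣p∣⇒∃q⊆p∣q∣≡m p m≤∣p∣
... | q , q⊆p , ∣q∣≡m = false ∷ q , out⊆ q⊆p , ∣q∣≡m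
m≤∣p∣⇒∃q⊆p∣q∣≡m {suc n} (true ∷ p) {zero} _ = ⊥ , ⊥⊆ , ∣⊥∣≡0 (suc n)
m≤∣p∣⇒∃q⊆p∣q∣≡m (true ∷ p)  {suc m} m≤∣p∣ with m≤∣p∣⇒∃q⊆p∣q∣≡m p (s≤s⁻¹ m≤∣p∣)
... | q , q⊆p , ∣q∣≡m = true ∷ q , s⊆s q⊆p , cong suc ∣q∣≡m

x∉p⇒∣⁅x⁆∪p∣≡1+∣p∣ : ∀ {x} (p : Subset n) → x ∉ p → ∣ ⁅ x ⁆ ∪ p ∣ ≡ suc ∣ p ∣
x∉p⇒∣⁅x⁆∪p∣≡1+∣p∣ {x = x} p x∉p =
  trans (∣p∪q∣≡∣p∣+∣q∣ ⁅ x ⁆ p λ y∈⁅x⁆ → subst (_∉ p) (sym (x∈⁅y⁆⇒x≡y x y∈⁅x⁆)) x∉p)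
        (cong (_+ ∣ p ∣) (∣⁅x⁆∣≡1 x))

x∈p⇒p∩[⁅x⁆∪q]≡⁅x⁆ : ∀ {x} (p q : Subset n) → x ∈ p → Disjoint q p → p ∩ (⁅ x ⁆ ∪ q) ≡ ⁅ x ⁆
x∈p⇒p∩[⁅x⁆∪q]≡⁅x⁆ {x = x} p q x∈p q#p = ⊆-antisym ⊆⁅x⁆ ⁅x⁆⊆
  where
  ⊆⁅x⁆ : p ∩ (⁅ x ⁆ ∪ q) ⊆ ⁅ x ⁆
  ⊆⁅x⁆ y∈p∩[⁅x⁆∪q] with x∈p∩q⁻ p _ y∈p∩[⁅x⁆∪q]
  ... | y∈p , y∈⁅x⁆∪q with x∈p∪q⁻ ⁅ x ⁆ q y∈⁅x⁆∪q
  ...   | inj₁ y∈⁅x⁆ = y∈⁅x⁆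
  ...   | inj₂ y∈q   = contradiction y∈p (q#p y∈q)
  ⁅x⁆⊆ : ⁅ x ⁆ ⊆ p ∩ (⁅ x ⁆ ∪ q)
  ⁅x⁆⊆ y∈⁅x⁆ rewrite x∈⁅y⁆⇒x≡y x y∈⁅x⁆ = x∈p∩q⁺ (x∈p , x∈p∪q⁺ (inj₁ (x∈⁅x⁆ x)))

∣N∩F∣≡1⇒∣N∣≤∣∁F∣ : ∀ {u} (N F : Subset n) → u ∉ N → u ∉ F → ∣ N ∩ F ∣ ≡ 1 → ∣ N ∣ ≤ ∣ ∁ F ∣
∣N∩F∣≡1⇒∣N∣≤∣∁F∣ {u = u} N F u∉N u∉F ∣N∩F∣≡1 = begin
  ∣ N ∣                     ≡⟨ ∣p∣≡∣p∩q∣+∣p∩∁q∣ N F ⟩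
  ∣ N ∩ F ∣ + ∣ N ∩ ∁ F ∣   ≡⟨ cong (_+ ∣ N ∩ ∁ F ∣) ∣N∩F∣≡1 ⟩
  1 + ∣ N ∩ ∁ F ∣           ≤⟨ p⊂q⇒∣p∣<∣q∣ N∩∁F⊂∁F ⟩
  ∣ ∁ F ∣                   ∎
  where
  open ≤-Reasoning
  N∩∁F⊂∁F : N ∩ ∁ F ⊂ ∁ F
  N∩∁F⊂∁F = p∩q⊆q N (∁ F) , u , x∉p⇒x∈∁p u∉F , u∉N ∘ proj₁ ∘ x∈p∩q⁻ N (∁ F)

⁅w⁆∪S-meets-N-once : ∀ {u w} (N S : Subset n) → u ∉ N → w ∈ N → Disjoint S (⁅ u ⁆ ∪ N) →
                     ∣ ⁅ w ⁆ ∪ S ∣ ≡ suc ∣ S ∣ × u ∉ ⁅ w ⁆ ∪ S × ∣ N ∩ (⁅ w ⁆ ∪ S) ∣ ≡ 1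
⁅w⁆∪S-meets-N-once {u = u} {w} N S u∉N w∈N S#⁅u⁆∪N =
  x∉p⇒∣⁅x⁆∪p∣≡1+∣p∣ S w∉S , u∉⁅w⁆∪S , trans (cong ∣_∣ N∩[⁅w⁆∪S]≡⁅w⁆) (∣⁅x⁆∣≡1 w)
  where
  S#N : Disjoint S N
  S#N x∈S = S#⁅u⁆∪N x∈S ∘ x∈p∪q⁺ ∘ inj₂
  w∉S : w ∉ S
  w∉S w∈S = S#N w∈S w∈N
  u∉⁅w⁆∪S : u ∉ ⁅ w ⁆ ∪ S
  u∉⁅w⁆∪S u∈⁅w⁆∪S with x∈p∪q⁻ ⁅ w ⁆ S u∈⁅w⁆∪S
  ... | inj₁ u∈⁅w⁆ = u∉N (subst (_∈ N) (sym (x∈⁅y⁆⇒x≡y w u∈⁅w⁆)) w∈N)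
  ... | inj₂ u∈S   = S#⁅u⁆∪N u∈S (x∈p∪q⁺ (inj₁ (x∈⁅x⁆ u)))
  N∩[⁅w⁆∪S]≡⁅w⁆ : N ∩ (⁅ w ⁆ ∪ S) ≡ ⁅ w ⁆
  N∩[⁅w⁆∪S]≡⁅w⁆ = x∈p⇒p∩[⁅x⁆∪q]≡⁅x⁆ N S w∈N S#N

∃F[∣F∣≡1+k×u∉F×∣N∩F∣≡1] : ∀ {u k} (N : Subset n) → u ∉ N → Nonempty N → suc k + ∣ N ∣ ≤ n →
                          ∃[ F ] ∣ F ∣ ≡ suc k × u ∉ F × ∣ N ∩ F ∣ ≡ 1
∃F[∣F∣≡1+k×u∉F×∣N∩F∣≡1] {n} {u} {k} N u∉N (w , w∈N) 1+k+∣N∣≤n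
  with m≤∣p∣⇒∃q⊆p∣q∣≡m (∁ (⁅ u ⁆ ∪ N)) k≤∣∁[⁅u⁆∪N]∣
  where
  k≤∣∁[⁅u⁆∪N]∣ : k ≤ ∣ ∁ (⁅ u ⁆ ∪ N) ∣
  k≤∣∁[⁅u⁆∪N]∣ rewrite ∣∁p∣≡n∸∣p∣ (⁅ u ⁆ ∪ N) | x∉p⇒∣⁅x⁆∪p∣≡1+∣p∣ N u∉N =
    m+n≤o⇒m≤o∸n k (subst (_≤ n) (sym (+-suc k ∣ N ∣)) 1+k+∣N∣≤n)
... | S , S⊆∁[⁅u⁆∪N] , ∣S∣≡k with ⁅w⁆∪S-meets-N-once N S u∉N w∈N (x∈∁p⇒x∉p ∘ S⊆∁[⁅u⁆∪N])
...   | ∣⁅w⁆∪S∣≡1+∣S∣ , u∉⁅w⁆∪S , ∣N∩[⁅w⁆∪S]∣≡1 =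
  ⁅ w ⁆ ∪ S , trans ∣⁅w⁆∪S∣≡1+∣S∣ (cong suc ∣S∣≡k) , u∉⁅w⁆∪S , ∣N∩[⁅w⁆∪S]∣≡1

countᵇ-tabulate : ∀ {a} {A : Set a} (p : A → Bool) (f : Fin n → A) → countᵇ p (tabulate f) ≡ ∣ tabulate (p ∘ f) ∣
countᵇ-tabulate {zero}  p f = refl
countᵇ-tabulate {suc n} p f with p (f zero)
... | true  = cong suc (countᵇ-tabulate p (f ∘ suc))
... | false = countᵇ-tabulate p (f ∘ suc)

tabulate-∧-lookup : ∀ (a : Fin n → Bool) (F : Subset n) → tabulate (λ v → a v ∧ lookup F v) ≡ tabulate a ∩ F
tabulate-∧-lookup a []      = refl
tabulate-∧-lookup a (x ∷ F) = cong (a zero ∧ x ∷_) (tabulate-∧-lookup (a ∘ suc) F)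

≤foldr₁-⊓⇔ : ∀ m (f : Fin (suc n) → ℕ) → m ≤ foldr₁ _⊓_ (tabulate f) ⇔ (∀ i → m ≤ f i)
≤foldr₁-⊓⇔ {zero}  m f = mk⇔ (λ { m≤f₀ zero → m≤f₀ }) (λ m≤f → m≤f zero)
≤foldr₁-⊓⇔ {suc n} m f = mk⇔ to from
  where
  rec = ≤foldr₁-⊓⇔ m (f ∘ suc)
  to : m ≤ f zero ⊓ foldr₁ _⊓_ (tabulate (f ∘ suc)) → ∀ i → m ≤ f i
  to m≤min zero    = m≤n⊓o⇒m≤n _ _ m≤min
  to m≤min (suc i) = Equivalence.to rec (m≤n⊓o⇒m≤o _ _ m≤min) i
  from : (∀ i → m ≤ f i) → m ≤ f zero ⊓ foldr₁ _⊓_ (tabulate (f ∘ suc))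
  from m≤f = ⊓-glb (m≤f zero) (Equivalence.from rec (m≤f ∘ suc))

EverySubsetOfSizeIsFort : Graph n → ℕ → Set
EverySubsetOfSizeIsFort {n} G k = (F : Subset n) → ∣ F ∣ ≡ k → IsFort G F

module _ {n} (G : Graph n) where

  neighbourhood : Fin n → Subset n
  neighbourhood u = tabulate (adj G u)

  u∉neighbourhood : ∀ u → u ∉ neighbourhood u
  u∉neighbourhood u u∈N
    with () ← trans (sym (irrefl G u)) (trans (sym (lookup∘tabulate (adj G u) u)) ([]=⇒lookup u∈N))

  degree≡∣neighbourhood∣ : ∀ u → degree G u ≡ ∣ neighbourhood u ∣
  degree≡∣neighbourhood∣ u = countᵇ-tabulate (adj G u) id

  neighboursIn≡∣neighbourhood∩F∣ : ∀ F u → neighboursIn G F u ≡ ∣ neighbourhood u ∩ F ∣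
  neighboursIn≡∣neighbourhood∩F∣ F u =
    trans (countᵇ-tabulate (λ v → adj G u v ∧ lookup F v) id) (cong ∣_∣ (tabulate-∧-lookup (adj G u) F))

  exactlyOneNeighbourIn⇒degree≤∣∁F∣ : ∀ {F u} → u ∉ F → neighboursIn G F u ≡ 1 → degree G u ≤ ∣ ∁ F ∣
  exactlyOneNeighbourIn⇒degree≤∣∁F∣ {F} {u} u∉F one =
    subst (_≤ ∣ ∁ F ∣) (sym (degree≡∣neighbourhood∣ u))
      (∣N∩F∣≡1⇒∣N∣≤∣∁F∣ (neighbourhood u) F (u∉neighbourhood u) u∉F
        (trans (sym (neighboursIn≡∣neighbourhood∩F∣ F u)) one))

  ∣∁F∣<degree⇒IsFort : ∀ {F} → Nonempty F → (∀ u → ∣ ∁ F ∣ < degree G u) → IsFort G F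
  ∣∁F∣<degree⇒IsFort F≢∅ ∣∁F∣<degree =
    F≢∅ , λ u u∉F one → <⇒≱ (∣∁F∣<degree u) (exactlyOneNeighbourIn⇒degree≤∣∁F∣ u∉F one)

  lowDegree⇒∃¬IsFort : NoIsolated G → ∀ {k u} → suc k + degree G u ≤ n → ∃[ F ] ∣ F ∣ ≡ suc k × ¬ IsFort G F
  lowDegree⇒∃¬IsFort noIsolated {k} {u} small
    with ∃F[∣F∣≡1+k×u∉F×∣N∩F∣≡1] (neighbourhood u) (u∉neighbourhood u)
           (0<∣p∣⇒Nonempty (subst (0 <_) (degree≡∣neighbourhood∣ u) (n≢0⇒n>0 (noIsolated u))))
           (subst (λ d → suc k + d ≤ n) (degree≡∣neighbourhood∣ u) small)
  ... | F , ∣F∣≡1+k , u∉F , one =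
    F , ∣F∣≡1+k , λ (_ , noSingleNeighbour) →
      noSingleNeighbour u u∉F (trans (neighboursIn≡∣neighbourhood∩F∣ F u) one)

  fortsOfSize⇔degree> : ∀ {k j} → k + j ≡ n → 0 < k → NoIsolated G →
                        EverySubsetOfSizeIsFort G k ⇔ (∀ u → j < degree G u)
  fortsOfSize⇔degree> {suc k} {j} k+j≡n (s≤s z≤n) noIsolated = mk⇔ to from
    where
    to : EverySubsetOfSizeIsFort G (suc k) → ∀ u → j < degree G u
    to forts u with j <? degree G u
    ... | yes j<degree = j<degree
    ... | no  j≮degree with lowDegree⇒∃¬IsFort noIsolated
                              (subst (suc k + degree G u ≤_) k+j≡n (+-monoʳ-≤ (suc k) (≮⇒≥ j≮degree)))
    ...   | F , ∣F∣≡1+k , ¬fort = contradiction (forts F ∣F∣≡1+k) ¬fort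
    from : (∀ u → j < degree G u) → EverySubsetOfSizeIsFort G (suc k)
    from j<degree F ∣F∣≡1+k =
      ∣∁F∣<degree⇒IsFort (0<∣p∣⇒Nonempty (subst (0 <_) (sym ∣F∣≡1+k) (s≤s z≤n)))
                          (λ u → subst (_< degree G u) (sym ∣∁F∣≡j) (j<degree u))
      where
      ∣∁F∣≡j : ∣ ∁ F ∣ ≡ j
      ∣∁F∣≡j = trans (∣∁p∣≡n∸∣p∣ F) (trans (cong₂ _∸_ (sym k+j≡n) ∣F∣≡1+k) (m+n∸m≡n (suc k) j))

≤minDegree⇔ : ∀ {m} (G : Graph (suc n)) → m ≤ minDegree G ⇔ (∀ u → m ≤ degree G u)
≤minDegree⇔ G = ≤foldr₁-⊓⇔ _ (degree G)

fortsOfSize⇔minDegree> : ∀ {k j} (G : Graph (suc n)) → k + j ≡ suc n → 0 < k → NoIsolated G →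
                         EverySubsetOfSizeIsFort G k ⇔ (j < minDegree G)
fortsOfSize⇔minDegree> G k+j≡n 0<k noIsolated =
  ⇔-sym (≤minDegree⇔ G) ⇔-∘ fortsOfSize⇔degree> G k+j≡n 0<k noIsolated

lemma3p2 : (n : ℕ) → 4 ≤ n → (G : Graph n) → NoIsolated G →
    (((F : Subset n) → ∣ F ∣ ≡ ⌊ n /2⌋ → IsFort G F) ⇔ (⌈ n /2⌉ + 1 ≤ minDegree G))
    × (((F : Subset n) → ∣ F ∣ ≡ ⌈ n /2⌉ → IsFort G F) ⇔ (⌊ n /2⌋ + 1 ≤ minDegree G))
lemma3p2 (suc n) 4≤n G noIsolated =
  +1≤ (fortsOfSize⇔minDegree> G ⌊n/2⌋+⌈n/2⌉≡1+n (<⇒≤ (⌊n/2⌋-mono 4≤n)) noIsolated) ,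
  +1≤ (fortsOfSize⇔minDegree> G ⌈n/2⌉+⌊n/2⌋≡1+n (<⇒≤ (⌈n/2⌉-mono 4≤n)) noIsolated)
  where
  ⌊n/2⌋+⌈n/2⌉≡1+n : ⌊ suc n /2⌋ + ⌈ suc n /2⌉ ≡ suc n
  ⌊n/2⌋+⌈n/2⌉≡1+n = ⌊n/2⌋+⌈n/2⌉≡n (suc n)
  ⌈n/2⌉+⌊n/2⌋≡1+n : ⌈ suc n /2⌉ + ⌊ suc n /2⌋ ≡ suc n
  ⌈n/2⌉+⌊n/2⌋≡1+n = trans (+-comm ⌈ suc n /2⌉ ⌊ suc n /2⌋) ⌊n/2⌋+⌈n/2⌉≡1+n
  +1≤ : ∀ {A : Set} {j} → A ⇔ (j < minDegree G) → A ⇔ (j + 1 ≤ minDegree G)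
  +1≤ {A} {j} = subst (λ m → A ⇔ (m ≤ minDegree G)) (+-comm 1 j)
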